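{- Let $k\geq 2$ be an integer and let $l>k$ be an odd prime. Let $p(n)$ denote the number of partitions of $n$ (with $p(0)=1$). Then for every nonnegative integer $n$, $$\tau_{ -k}(n+1)\equiv\sum_{\substack{n=t+ls\\ t,s\geq 0}}\tau_{l-k}(t+1)\,p(s)\pmod{l}.$$ Equivalently, $$\sum_{\substack{n=a_1+a_2+\cdots+a_k\\ a_i\in\mathbb{N}\cup\{0\}}}p(a_1)p(a_2)\cdots p(a_k)\equiv\sum_{\substack{n=t+ls\\ t,s\geq 0}}\tau_{l-k}(t+1)\,p(s)\pmod{l}.$$
   Context: For a nonzero integer $k$, the arithmetical function $\tau_k$ is defined by $q\prod_{m=1}^{\infty}(1-q^m)^k=\sum_{n=1}^{\infty}\tau_k(n)q^n$. In particular $\prod_{m\ge1}(1-q^m)^{ -k}=\sum_{n\ge0}\tau_{ -k}(n+1)q^n$, and the left-hand sum in the second form runs over all ordered $k$-tuples of nonnegative integers summing to $n$. -}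

module Defs where

open import Data.Nat as ℕ using (ℕ; zero; suc; _∸_)
open import Data.Integer as ℤ using (ℤ; +_; -[1+_]; _+_; _*_; _-_)
open import Relation.Nullary using (yes; no)

Series : Set
Series = ℕ → ℤ

Σ≤ : ℕ → (ℕ → ℤ) → ℤ
Σ≤ zero    f = f zero
Σ≤ (suc n) f = Σ≤ n f + f (suc n)

one : Series
one zero    = + 1
one (suc _) = + 0

_⊛_ : Series → Series → Series
(f ⊛ g) n = Σ≤ n (λ i → f i * g (n ∸ i))

pow : Series → ℕ → Series
pow f zero    = one
pow f (suc j) = f ⊛ pow f j

-- 1 - q^m   (m ≥ 1 in all uses)
oneMinusQ : ℕ → Series
oneMinusQ m zero = + 1
oneMinusQ m (suc n) with ℕ._≟_ (suc n) m
... | yes _ = ℤ.-[1+ 0 ]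
... | no  _ = + 0

-- 1/(1 - q^m) = Σ_{j ≥ 0} q^{m j}   (m ≥ 1 in all uses)
geomQ : ℕ → Series
geomQ m n with m
... | zero  = one n
... | suc m' with n ℕ.% suc m'
...   | zero  = + 1
...   | suc _ = + 0

-- (1 - q^m)^k for k ∈ ℤ
factor : ℤ → ℕ → Series
factor (+ j)     m = pow (oneMinusQ m) j
factor -[1+ j ]  m = pow (geomQ m) (suc j)

partialProd : ℤ → ℕ → Series
partialProd k zero    = one
partialProd k (suc M) = factor k (suc M) ⊛ partialProd k M

-- coefficient of q^n in ∏_{m ≥ 1} (1 - q^m)^k.  Factors with m > n are
-- ≡ 1 modulo q^{n+1}, so the finite product over m = 1..n gives the
-- exact coefficient of the infinite product.
etaCoeff : ℤ → ℕ → ℤ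
etaCoeff k n = partialProd k n n

-- τ_k defined by  q ∏_{m ≥ 1} (1 - q^m)^k = Σ_{n ≥ 1} τ_k(n) q^n
τ : ℤ → ℕ → ℤ
τ k zero    = + 0
τ k (suc n) = etaCoeff k n

-- partition function: Σ_{n ≥ 0} p(n) q^n = ∏_{m ≥ 1} (1 - q^m)^{-1}
p : ℕ → ℤ
p n = etaCoeff (ℤ.- (+ 1)) n

-- Σ over n = t + l s with t, s ≥ 0 of f t s   (l ≥ 1)
Σsplit : ℕ → ℕ → (ℕ → ℕ → ℤ) → ℤ
Σsplit l n f = Σ≤ n (λ s → g s)
  where
  g : ℕ → ℤ
  g s with ℕ._≤?_ (l ℕ.* s) n
  ... | yes _ = f (n ∸ l ℕ.* s) s
  ... | no _ = + 0

module Submission where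

-- Modulo a prime l, Frobenius gives (1 - q^m)^l ≡ 1 - q^{lm}, hence for 1 ≤ k ≤ l
--   (1 - q^m)^{-k} = (1 - q^m)^{l-k} (1 - q^m)^{-l} ≡ (1 - q^m)^{l-k} / (1 - q^{lm}).
-- Multiplying over m, ∏ (1 - q^m)^{-k} ≡ ∏ (1 - q^m)^{l-k} · P(q^l) with P(q) = Σ p(n) q^n,
-- and the coefficient of q^n on the right is Σ_{t + l s = n} τ_{l-k}(t+1) p(s).

open import Data.Nat using (ℕ; _≤_; _<_; _%_)
open import Data.Nat.Primality using (Prime)
open import Relation.Binary.PropositionalEquality using (_≡_)

open import Data.Nat as ℕ using (zero; suc; z≤n; s≤s; _∸_; _≟_; _≤?_; NonZero)
import Data.Nat.Properties as ℕ
import Data.Nat.DivMod as DM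
import Data.Nat.Divisibility as ℕ
open import Data.Nat.Base using (_!; nonTrivial⇒n>1)
open import Data.Nat.Primality using (euclidsLemma; prime⇒nonZero)
open import Data.Nat.Combinatorics using (_C_; nCn≡1; nCk≡n!/k![n-k]!; k![n∸k]!∣n!)
open import Data.Fin using (Fin; toℕ; fromℕ; inject₁)
import Data.Fin as Fin
import Data.Fin.Properties as Fin
open import Data.Sum using (inj₁; inj₂)
open import Data.Empty using (⊥-elim)
open import Data.Product using (_,_)
open import Function using (_∘_)
open import Level using (0ℓ)
open import Relation.Nullary using (Dec; yes; no)
open import Relation.Binary.PropositionalEquality
  using (_≢_; _≗_; refl; sym; trans; cong; cong₂; subst; subst₂; module ≡-Reasoning)
open import Relation.Binary.Structures using (IsEquivalence)
open import Algebra.Bundles using (CommutativeSemiring)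
open import Algebra.Structures.Biased using (isCommutativeSemiringˡ)

-- Primes and the freshman's dream

prime∤! : ∀ {p j} → Prime p → j < p → p ℕ.∤ j !
prime∤! {p} {zero} pr@record{} _ = ℕ.>⇒∤ (nonTrivial⇒n>1 p)
prime∤! {p} {suc j} pr j<p p∣j! with euclidsLemma (suc j) (j !) pr p∣j!
... | inj₁ p∣1+j = ℕ.>⇒∤ j<p p∣1+j
... | inj₂ p∣j!  = prime∤! pr (ℕ.<-trans (ℕ.n<1+n j) j<p) p∣j!

nCk*k![n∸k]!≡n! : ∀ {n k} → k ≤ n → (n C k) ℕ.* (k ! ℕ.* (n ∸ k) !) ≡ n !
nCk*k![n∸k]!≡n! {n} {k} k≤n =
  trans (cong (ℕ._* (k ! ℕ.* (n ∸ k) !)) (nCk≡n!/k![n-k]! k≤n)) (DM.m/n*n≡m (k![n∸k]!∣n! k≤n))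
  where
  instance
    k![n∸k]!≢0 : NonZero (k ! ℕ.* (n ∸ k) !)
    k![n∸k]!≢0 = k ℕ.!* (n ∸ k) !≢0

prime∣pCk : ∀ {p k} → Prime p → 0 < k → k < p → p ℕ.∣ p C k
prime∣pCk {p@(suc p-1)} {k} pr 0<k k<p
  with euclidsLemma (p C k) (k ! ℕ.* (p ∸ k) !) pr
         (subst (p ℕ.∣_) (sym (nCk*k![n∸k]!≡n! (ℕ.<⇒≤ k<p))) (ℕ.m∣m*n (p-1 !)))
... | inj₁ p∣pCk = p∣pCk
... | inj₂ p∣k![p∸k]! with euclidsLemma (k !) ((p ∸ k) !) pr p∣k![p∸k]!
...   | inj₁ p∣k!     = ⊥-elim (prime∤! pr k<p p∣k!)
...   | inj₂ p∣[p∸k]! = ⊥-elim (prime∤! pr (ℕ.∸-monoʳ-< 0<k (ℕ.<⇒≤ k<p)) p∣[p∸k]!)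

module _ {c ℓ} (S : CommutativeSemiring c ℓ) where
  open CommutativeSemiring S hiding (refl; sym; trans)
  open CommutativeSemiring S using () renaming (refl to ≈-refl; sym to ≈-sym; trans to ≈-trans)
  open import Algebra.Properties.Semiring.Exp semiring using (_^_; ^-congˡ; ^-congʳ; ^-homo-*)
  open import Algebra.Properties.CommutativeSemiring.Exp S using (^-distrib-*)
  open import Algebra.Properties.Monoid.Mult +-monoid using (_×_; ×-congˡ; ×-assocˡ; ×-homo-1)
  open import Algebra.Properties.Monoid.Sum +-monoid using (sum; sum-cong-≋; sum-init-last; sum-replicate-zero)
  open import Algebra.Properties.CommutativeSemiring.Binomial S using (theorem; binomialTerm)
  open import Relation.Binary.Reasoning.Setoid setoid

  1#^≈1# : ∀ k → 1# ^ k ≈ 1#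
  1#^≈1# zero    = ≈-refl
  1#^≈1# (suc k) = ≈-trans (*-identityˡ (1# ^ k)) (1#^≈1# k)

  power-of-inverse : ∀ {x y z w l k} → x * y ≈ 1# → z * w ≈ 1# → y ^ l ≈ z → k ≤ l →
                     x ^ k ≈ y ^ (l ∸ k) * w
  power-of-inverse {x} {y} {z} {w} {l} {k} xy≈1 zw≈1 yˡ≈z k≤l = begin
    x ^ k                                  ≈⟨ *-identityʳ (x ^ k) ⟨
    x ^ k * 1#                             ≈⟨ *-congˡ zw≈1 ⟨
    x ^ k * (z * w)                        ≈⟨ *-congˡ (*-congʳ z≈yᵏyˡ⁻ᵏ) ⟩
    x ^ k * ((y ^ k * y ^ (l ∸ k)) * w)    ≈⟨ *-congˡ (*-assoc (y ^ k) (y ^ (l ∸ k)) w) ⟩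
    x ^ k * (y ^ k * (y ^ (l ∸ k) * w))    ≈⟨ *-assoc (x ^ k) (y ^ k) _ ⟨
    (x ^ k * y ^ k) * (y ^ (l ∸ k) * w)    ≈⟨ *-congʳ (^-distrib-* x y k) ⟨
    (x * y) ^ k * (y ^ (l ∸ k) * w)        ≈⟨ *-congʳ (≈-trans (^-congˡ k xy≈1) (1#^≈1# k)) ⟩
    1# * (y ^ (l ∸ k) * w)                 ≈⟨ *-identityˡ _ ⟩
    y ^ (l ∸ k) * w                        ∎
    where
    z≈yᵏyˡ⁻ᵏ : z ≈ y ^ k * y ^ (l ∸ k)
    z≈yᵏyˡ⁻ᵏ = ≈-trans (≈-sym yˡ≈z) (≈-trans (^-congʳ y (sym (ℕ.m+[n∸m]≡n k≤l))) (^-homo-* y k (l ∸ k)))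

  freshmans-dream : ∀ {p} → Prime p → (∀ z → p × z ≈ 0#) → ∀ x y → (x + y) ^ p ≈ x ^ p + y ^ p
  freshmans-dream {p@(suc p-1)} pr p×≈0 x y = begin
    (x + y) ^ p                                          ≈⟨ theorem p x y ⟩
    term Fin.zero + sum (term ∘ Fin.suc)                 ≈⟨ +-congˡ (sum-init-last (term ∘ Fin.suc)) ⟩
    term Fin.zero + (sum middle + term (fromℕ p))        ≈⟨ +-cong first (+-cong middle≈0 lastTerm) ⟩
    y ^ p + (0# + x ^ p)                                 ≈⟨ +-congˡ (+-identityˡ (x ^ p)) ⟩
    y ^ p + x ^ p                                        ≈⟨ +-comm (y ^ p) (x ^ p) ⟩
    x ^ p + y ^ p                                        ∎
    where
    term : Fin (suc p) → Carrier
    term = binomialTerm x y p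
    middle : Fin p-1 → Carrier
    middle i = term (Fin.suc (inject₁ i))
    first : term Fin.zero ≈ y ^ p
    first = ≈-trans (+-identityʳ _) (*-identityˡ (y ^ p))
    lastTerm : term (fromℕ p) ≈ x ^ p
    lastTerm = begin
      (p C p') × (x ^ p' * y ^ (p ∸ p'))   ≈⟨ ×-congˡ (trans (cong (p C_) p'≡p) (nCn≡1 p)) ⟩
      1 × (x ^ p' * y ^ (p ∸ p'))          ≈⟨ ×-homo-1 _ ⟩
      x ^ p' * y ^ (p ∸ p')                ≈⟨ *-cong (^-congʳ x p'≡p) (^-congʳ y p∸p'≡0) ⟩
      x ^ p * 1#                           ≈⟨ *-identityʳ (x ^ p) ⟩
      x ^ p                                ∎
      where
      p' : ℕ
      p' = toℕ (fromℕ p)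
      p'≡p : p' ≡ p
      p'≡p = Fin.toℕ-fromℕ p
      p∸p'≡0 : p ∸ p' ≡ 0
      p∸p'≡0 = trans (cong (p ∸_) p'≡p) (ℕ.n∸n≡0 p)
    middle≈0 : sum middle ≈ 0#
    middle≈0 = ≈-trans (sum-cong-≋ (λ i → p∣⇒p×≈0 (prime∣pCk pr (s≤s z≤n) (s≤s (Fin.inject₁ℕ< i)))))
                       (sum-replicate-zero p-1)
      where
      p∣⇒p×≈0 : ∀ {n z} → p ℕ.∣ n → n × z ≈ 0#
      p∣⇒p×≈0 {z = z} (ℕ.divides q refl) = begin
        (q ℕ.* p) × z  ≈⟨ ×-congˡ (ℕ.*-comm q p) ⟩
        (p ℕ.* q) × z  ≈⟨ ×-assocˡ z p q ⟨
        p × (q × z)    ≈⟨ p×≈0 (q × z) ⟩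
        0#             ∎

-- ℤ is opened only from here on: its _+_ and _*_ would clash with the semiring operations above.
open import Defs
open import Data.Integer using (ℤ; +_; -_; _-_; _*_)
open import Data.Integer.Divisibility using (_∣_)

open import Data.Integer as ℤ using (_+_; 0ℤ; 1ℤ; -1ℤ; -[1+_])
import Data.Integer.Properties as ℤ
import Data.Integer.Divisibility.Signed as Signed
open import Data.Integer.Tactic.RingSolver using (solve-∀)
open import Algebra.Properties.CommutativeSemigroup ℤ.+-commutativeSemigroup
  using (interchange)

open ≡-Reasoning

-- Finite sums

Σ≤-cong : ∀ n {f g : ℕ → ℤ} → (∀ i → i ≤ n → f i ≡ g i) → Σ≤ n f ≡ Σ≤ n g
Σ≤-cong zero    f≡g = f≡g 0 z≤n
Σ≤-cong (suc n) f≡g =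
  cong₂ _+_ (Σ≤-cong n (λ i i≤n → f≡g i (ℕ.m≤n⇒m≤1+n i≤n))) (f≡g (suc n) ℕ.≤-refl)

Σ≤-zero : ∀ n {f : ℕ → ℤ} → (∀ i → i ≤ n → f i ≡ 0ℤ) → Σ≤ n f ≡ 0ℤ
Σ≤-zero zero    f≡0 = f≡0 0 z≤n
Σ≤-zero (suc n) f≡0 =
  cong₂ _+_ (Σ≤-zero n (λ i i≤n → f≡0 i (ℕ.m≤n⇒m≤1+n i≤n))) (f≡0 (suc n) ℕ.≤-refl)

Σ≤-distrib-+ : ∀ n (f g : ℕ → ℤ) → Σ≤ n (λ i → f i + g i) ≡ Σ≤ n f + Σ≤ n g
Σ≤-distrib-+ zero    f g = refl
Σ≤-distrib-+ (suc n) f g = trans (cong (_+ (f (suc n) + g (suc n))) (Σ≤-distrib-+ n f g))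
                                 (interchange (Σ≤ n f) (Σ≤ n g) (f (suc n)) (g (suc n)))

*-distribˡ-Σ≤ : ∀ n c (f : ℕ → ℤ) → c * Σ≤ n f ≡ Σ≤ n (λ i → c * f i)
*-distribˡ-Σ≤ zero    c f = refl
*-distribˡ-Σ≤ (suc n) c f = trans (ℤ.*-distribˡ-+ c (Σ≤ n f) (f (suc n)))
                                  (cong (_+ c * f (suc n)) (*-distribˡ-Σ≤ n c f))

*-distribʳ-Σ≤ : ∀ n c (f : ℕ → ℤ) → Σ≤ n f * c ≡ Σ≤ n (λ i → f i * c)
*-distribʳ-Σ≤ zero    c f = refl
*-distribʳ-Σ≤ (suc n) c f = trans (ℤ.*-distribʳ-+ c (Σ≤ n f) (f (suc n)))
                                  (cong (_+ f (suc n) * c) (*-distribʳ-Σ≤ n c f))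

Σ≤-*-Σ≤ : ∀ n m (f g : ℕ → ℤ) → Σ≤ n f * Σ≤ m g ≡ Σ≤ n (λ i → Σ≤ m (λ j → f i * g j))
Σ≤-*-Σ≤ n m f g = trans (*-distribʳ-Σ≤ n (Σ≤ m g) f)
                        (Σ≤-cong n (λ i _ → *-distribˡ-Σ≤ m (f i) g))

Σ≤-unfoldˡ : ∀ n (f : ℕ → ℤ) → Σ≤ (suc n) f ≡ f 0 + Σ≤ n (λ i → f (suc i))
Σ≤-unfoldˡ zero    f = refl
Σ≤-unfoldˡ (suc n) f = trans (cong (_+ f (suc (suc n))) (Σ≤-unfoldˡ n f))
                             (ℤ.+-assoc (f 0) (Σ≤ n (λ i → f (suc i))) (f (suc (suc n))))

Σ≤-reverse : ∀ n (f : ℕ → ℤ) → Σ≤ n f ≡ Σ≤ n (λ i → f (n ∸ i))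
Σ≤-reverse zero    f = refl
Σ≤-reverse (suc n) f = begin
  Σ≤ n f + f (suc n)                  ≡⟨ cong (_+ f (suc n)) (Σ≤-reverse n f) ⟩
  Σ≤ n (λ i → f (n ∸ i)) + f (suc n)  ≡⟨ ℤ.+-comm _ (f (suc n)) ⟩
  f (suc n) + Σ≤ n (λ i → f (n ∸ i))  ≡⟨ Σ≤-unfoldˡ n (λ i → f (suc n ∸ i)) ⟨
  Σ≤ (suc n) (λ i → f (suc n ∸ i))    ∎

Σ≤-comm : ∀ n m (F : ℕ → ℕ → ℤ) →
          Σ≤ n (λ i → Σ≤ m (F i)) ≡ Σ≤ m (λ j → Σ≤ n (λ i → F i j))
Σ≤-comm zero    m F = refl
Σ≤-comm (suc n) m F = trans (cong (_+ Σ≤ m (F (suc n))) (Σ≤-comm n m F))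
                            (sym (Σ≤-distrib-+ m (λ j → Σ≤ n (λ i → F i j)) (F (suc n))))

Σ≤-rotate : ∀ n m k (F : ℕ → ℕ → ℕ → ℤ) →
            Σ≤ n (λ i → Σ≤ m (λ a → Σ≤ k (F i a))) ≡
            Σ≤ m (λ a → Σ≤ k (λ b → Σ≤ n (λ i → F i a b)))
Σ≤-rotate n m k F = trans (Σ≤-comm n m (λ i a → Σ≤ k (F i a)))
                          (Σ≤-cong m (λ a _ → Σ≤-comm n k (λ i → F i a)))

Σ≤-single : ∀ n {a} {f : ℕ → ℤ} → a ≤ n → (∀ i → i ≤ n → i ≢ a → f i ≡ 0ℤ) → Σ≤ n f ≡ f a
Σ≤-single zero    z≤n _ = refl
Σ≤-single (suc n) {a} {f} a≤1+n others with ℕ.m≤n⇒m<n∨m≡n a≤1+n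
... | inj₁ a<1+n = trans (cong₂ _+_ (Σ≤-single n (ℕ.≤-pred a<1+n) others-below)
                                    (others (suc n) ℕ.≤-refl (ℕ.>⇒≢ a<1+n)))
                         (ℤ.+-identityʳ (f a))
  where
  others-below : ∀ i → i ≤ n → i ≢ a → f i ≡ 0ℤ
  others-below i i≤n = others i (ℕ.m≤n⇒m≤1+n i≤n)
... | inj₂ refl = trans (cong (_+ f (suc n)) (Σ≤-zero n below))
                        (ℤ.+-identityˡ (f (suc n)))
  where
  below : ∀ i → i ≤ n → f i ≡ 0ℤ
  below i i≤n = others i (ℕ.m≤n⇒m≤1+n i≤n) (ℕ.<⇒≢ (s≤s i≤n))

Σ≤-extend : ∀ {n} N {f : ℕ → ℤ} → n ≤ N → (∀ i → n < i → f i ≡ 0ℤ) → Σ≤ N f ≡ Σ≤ n f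
Σ≤-extend zero    z≤n _ = refl
Σ≤-extend (suc N) {f} n≤1+N beyond with ℕ.m≤n⇒m<n∨m≡n n≤1+N
... | inj₁ n<1+N = trans (cong₂ _+_ (Σ≤-extend N (ℕ.≤-pred n<1+N) beyond) (beyond (suc N) n<1+N))
                         (ℤ.+-identityʳ _)
... | inj₂ refl  = refl

-- Arithmetic of power series

𝟘 : Series
𝟘 _ = 0ℤ

infixl 6 _⊕_
_⊕_ : Series → Series → Series
(f ⊕ g) n = f n + g n

shift : Series → Series
shift f n = f (suc n)

⊛-unfold : ∀ f g n → (f ⊛ g) (suc n) ≡ f 0 * g (suc n) + (shift f ⊛ g) n
⊛-unfold f g n = Σ≤-unfoldˡ n (λ i → f i * g (suc n ∸ i))

⊛-cong : ∀ {f f' g g'} → f ≗ f' → g ≗ g' → f ⊛ g ≗ f' ⊛ g'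
⊛-cong f≗f' g≗g' n = Σ≤-cong n (λ i _ → cong₂ _*_ (f≗f' i) (g≗g' (n ∸ i)))

⊛-comm : ∀ f g → f ⊛ g ≗ g ⊛ f
⊛-comm f g n = begin
  Σ≤ n (λ i → f i * g (n ∸ i))             ≡⟨ Σ≤-reverse n _ ⟩
  Σ≤ n (λ i → f (n ∸ i) * g (n ∸ (n ∸ i)))  ≡⟨ Σ≤-cong n reindex ⟩
  Σ≤ n (λ i → g i * f (n ∸ i))             ∎
  where
  reindex : ∀ i → i ≤ n → f (n ∸ i) * g (n ∸ (n ∸ i)) ≡ g i * f (n ∸ i)
  reindex i i≤n = trans (cong (λ j → f (n ∸ i) * g j) (ℕ.m∸[m∸n]≡n i≤n)) (ℤ.*-comm (f (n ∸ i)) (g i))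

⊛-zeroˡ : ∀ g → 𝟘 ⊛ g ≗ 𝟘
⊛-zeroˡ g n = Σ≤-zero n (λ i _ → ℤ.*-zeroˡ (g (n ∸ i)))

⊛-identityˡ : ∀ g → one ⊛ g ≗ g
⊛-identityˡ g zero    = ℤ.*-identityˡ (g 0)
⊛-identityˡ g (suc n) = begin
  (one ⊛ g) (suc n)                ≡⟨ ⊛-unfold one g n ⟩
  1ℤ * g (suc n) + (𝟘 ⊛ g) n       ≡⟨ cong₂ _+_ (ℤ.*-identityˡ (g (suc n))) (⊛-zeroˡ g n) ⟩
  g (suc n) + 0ℤ                   ≡⟨ ℤ.+-identityʳ (g (suc n)) ⟩
  g (suc n)                        ∎

⊛-identityʳ : ∀ f → f ⊛ one ≗ f
⊛-identityʳ f n = trans (⊛-comm f one n) (⊛-identityˡ f n)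

⊛-distribʳ : ∀ f f' g → (f ⊕ f') ⊛ g ≗ (f ⊛ g) ⊕ (f' ⊛ g)
⊛-distribʳ f f' g n = trans (Σ≤-cong n (λ i _ → ℤ.*-distribʳ-+ (g (n ∸ i)) (f i) (f' i)))
                            (Σ≤-distrib-+ n _ _)

⊛-linearˡ : ∀ c f f' g n →
            ((λ i → c * f i + f' i) ⊛ g) n ≡ c * (f ⊛ g) n + (f' ⊛ g) n
⊛-linearˡ c f f' g n = begin
  Σ≤ n (λ i → (c * f i + f' i) * g (n ∸ i))
    ≡⟨ Σ≤-cong n (λ i _ → distrib (f i) (f' i) (g (n ∸ i))) ⟩
  Σ≤ n (λ i → c * (f i * g (n ∸ i)) + f' i * g (n ∸ i))
    ≡⟨ Σ≤-distrib-+ n _ _ ⟩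
  Σ≤ n (λ i → c * (f i * g (n ∸ i))) + (f' ⊛ g) n
    ≡⟨ cong (_+ (f' ⊛ g) n) (*-distribˡ-Σ≤ n c _) ⟨
  c * (f ⊛ g) n + (f' ⊛ g) n
    ∎
  where
  distrib : ∀ x y z → (c * x + y) * z ≡ c * (x * z) + y * z
  distrib x y z = trans (ℤ.*-distribʳ-+ z (c * x) y) (cong (_+ y * z) (ℤ.*-assoc c x z))

⊛-assoc : ∀ f g h → (f ⊛ g) ⊛ h ≗ f ⊛ (g ⊛ h)
⊛-assoc f g h zero    = ℤ.*-assoc (f 0) (g 0) (h 0)
⊛-assoc f g h (suc n) = begin
  ((f ⊛ g) ⊛ h) (suc n)
    ≡⟨ ⊛-unfold (f ⊛ g) h n ⟩
  f₀g₀h + (shift (f ⊛ g) ⊛ h) n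
    ≡⟨ cong (λ x → f₀g₀h + x) (⊛-cong {g = h} (⊛-unfold f g) (λ _ → refl) n) ⟩
  f₀g₀h + ((λ i → f 0 * shift g i + (shift f ⊛ g) i) ⊛ h) n
    ≡⟨ cong (λ x → f₀g₀h + x) (⊛-linearˡ (f 0) (shift g) (shift f ⊛ g) h n) ⟩
  f₀g₀h + (f 0 * (shift g ⊛ h) n + ((shift f ⊛ g) ⊛ h) n)
    ≡⟨ cong (λ x → f₀g₀h + (f 0 * (shift g ⊛ h) n + x)) (⊛-assoc (shift f) g h n) ⟩
  f₀g₀h + (f 0 * (shift g ⊛ h) n + (shift f ⊛ (g ⊛ h)) n)
    ≡⟨ regroup (f 0) (g 0) (h (suc n)) _ _ ⟩
  f 0 * (g 0 * h (suc n) + (shift g ⊛ h) n) + (shift f ⊛ (g ⊛ h)) n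
    ≡⟨ cong (λ x → f 0 * x + (shift f ⊛ (g ⊛ h)) n) (⊛-unfold g h n) ⟨
  f 0 * (g ⊛ h) (suc n) + (shift f ⊛ (g ⊛ h)) n
    ≡⟨ ⊛-unfold f (g ⊛ h) n ⟨
  (f ⊛ (g ⊛ h)) (suc n)
    ∎
  where
  f₀g₀h : ℤ
  f₀g₀h = f 0 * g 0 * h (suc n)
  regroup : ∀ a b c x y → a * b * c + (a * x + y) ≡ a * (b * c + x) + y
  regroup = solve-∀

infix 7 _·q^_
_·q^_ : ℤ → ℕ → Series
(c ·q^ a) n with a ≟ n
... | yes _ = c
... | no  _ = 0ℤ

·q^-≡ : ∀ c {a n} → a ≡ n → (c ·q^ a) n ≡ c
·q^-≡ c {a} {n} a≡n with a ≟ n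
... | yes _   = refl
... | no  a≢n = ⊥-elim (a≢n a≡n)

·q^-≢ : ∀ c {a n} → a ≢ n → (c ·q^ a) n ≡ 0ℤ
·q^-≢ c {a} {n} a≢n with a ≟ n
... | yes a≡n = ⊥-elim (a≢n a≡n)
... | no  _   = refl

0·q^ : ∀ a n → (0ℤ ·q^ a) n ≡ 0ℤ
0·q^ a n with a ≟ n
... | yes _ = refl
... | no  _ = refl

+-·q^ : ∀ c c' a n → ((c + c') ·q^ a) n ≡ (c ·q^ a) n + (c' ·q^ a) n
+-·q^ c c' a n with a ≟ n
... | yes _ = refl
... | no  _ = refl

Σ≤-·q^ : ∀ m (F : ℕ → ℤ) a n → (Σ≤ m F ·q^ a) n ≡ Σ≤ m (λ j → (F j ·q^ a) n)
Σ≤-·q^ m F a n with a ≟ n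
... | yes _ = refl
... | no  _ = sym (Σ≤-zero m (λ _ _ → refl))

one≗1·q^0 : one ≗ 1ℤ ·q^ 0
one≗1·q^0 zero    = refl
one≗1·q^0 (suc n) = refl

·q^-⊛ : ∀ c {a} g {n} → a ≤ n → ((c ·q^ a) ⊛ g) n ≡ c * g (n ∸ a)
·q^-⊛ c {a} g {n} a≤n = trans (Σ≤-single n a≤n others) (cong (_* g (n ∸ a)) (·q^-≡ c {a} refl))
  where
  others : ∀ i → i ≤ n → i ≢ a → (c ·q^ a) i * g (n ∸ i) ≡ 0ℤ
  others i _ i≢a = trans (cong (_* g (n ∸ i)) (·q^-≢ c (i≢a ∘ sym))) (ℤ.*-zeroˡ (g (n ∸ i)))

·q^-⊛-> : ∀ c {a} g {n} → n < a → ((c ·q^ a) ⊛ g) n ≡ 0ℤ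
·q^-⊛-> c {a} g {n} n<a = Σ≤-zero n vanish
  where
  vanish : ∀ i → i ≤ n → (c ·q^ a) i * g (n ∸ i) ≡ 0ℤ
  vanish i i≤n = trans (cong (_* g (n ∸ i)) (·q^-≢ c (ℕ.>⇒≢ (ℕ.≤-<-trans i≤n n<a))))
                       (ℤ.*-zeroˡ (g (n ∸ i)))

·q^-⊛-·q^ : ∀ c c' a b → (c ·q^ a) ⊛ (c' ·q^ b) ≗ (c * c') ·q^ (a ℕ.+ b)
·q^-⊛-·q^ c c' a b n with a ≤? n
... | no  a≰n = trans (·q^-⊛-> c (c' ·q^ b) (ℕ.≰⇒> a≰n)) (sym (·q^-≢ (c * c') a+b≢n))
  where
  a+b≢n : a ℕ.+ b ≢ n
  a+b≢n a+b≡n = a≰n (subst (a ≤_) a+b≡n (ℕ.m≤m+n a b))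
... | yes a≤n with b ≟ n ∸ a
...   | yes b≡n∸a = begin
  ((c ·q^ a) ⊛ (c' ·q^ b)) n  ≡⟨ ·q^-⊛ c (c' ·q^ b) a≤n ⟩
  c * (c' ·q^ b) (n ∸ a)      ≡⟨ cong (c *_) (·q^-≡ c' b≡n∸a) ⟩
  c * c'                      ≡⟨ ·q^-≡ (c * c') (trans (cong (a ℕ.+_) b≡n∸a) (ℕ.m+[n∸m]≡n a≤n)) ⟨
  ((c * c') ·q^ (a ℕ.+ b)) n  ∎
...   | no  b≢n∸a = begin
  ((c ·q^ a) ⊛ (c' ·q^ b)) n  ≡⟨ ·q^-⊛ c (c' ·q^ b) a≤n ⟩
  c * (c' ·q^ b) (n ∸ a)      ≡⟨ cong (c *_) (·q^-≢ c' b≢n∸a) ⟩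
  c * 0ℤ                      ≡⟨ ℤ.*-zeroʳ c ⟩
  0ℤ                          ≡⟨ ·q^-≢ (c * c') a+b≢n ⟨
  ((c * c') ·q^ (a ℕ.+ b)) n  ∎
  where
  a+b≢n : a ℕ.+ b ≢ n
  a+b≢n a+b≡n = b≢n∸a (trans (sym (ℕ.m+n∸m≡n a b)) (cong (_∸ a) a+b≡n))

pow-·q^ : ∀ c a j → pow (c ·q^ a) j ≗ (c ℤ.^ j) ·q^ (j ℕ.* a)
pow-·q^ c a zero    = one≗1·q^0
pow-·q^ c a (suc j) n = trans (⊛-cong {c ·q^ a} (λ _ → refl) (pow-·q^ c a j) n)
                              (·q^-⊛-·q^ c (c ℤ.^ j) a (j ℕ.* a) n)

⊛-as-double-sum : ∀ f g {n} N → n ≤ N →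
  (f ⊛ g) n ≡ Σ≤ N (λ a → Σ≤ N (λ b → ((f a * g b) ·q^ (a ℕ.+ b)) n))
⊛-as-double-sum f g {n} N n≤N = begin
  Σ≤ n (λ a → f a * g (n ∸ a))                                 ≡⟨ Σ≤-cong n (λ a → sym ∘ inner a) ⟩
  Σ≤ n (λ a → Σ≤ N (λ b → ((f a * g b) ·q^ (a ℕ.+ b)) n))      ≡⟨ Σ≤-extend N n≤N outer ⟨
  Σ≤ N (λ a → Σ≤ N (λ b → ((f a * g b) ·q^ (a ℕ.+ b)) n))      ∎
  where
  inner : ∀ a → a ≤ n → Σ≤ N (λ b → ((f a * g b) ·q^ (a ℕ.+ b)) n) ≡ f a * g (n ∸ a)
  inner a a≤n = trans (Σ≤-single N (ℕ.≤-trans (ℕ.m∸n≤m n a) n≤N) others)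
                      (·q^-≡ _ (ℕ.m+[n∸m]≡n a≤n))
    where
    others : ∀ b → b ≤ N → b ≢ n ∸ a → ((f a * g b) ·q^ (a ℕ.+ b)) n ≡ 0ℤ
    others b _ b≢n∸a = ·q^-≢ _ (λ a+b≡n → b≢n∸a (trans (sym (ℕ.m+n∸m≡n a b)) (cong (_∸ a) a+b≡n)))
  outer : ∀ a → n < a → Σ≤ N (λ b → ((f a * g b) ·q^ (a ℕ.+ b)) n) ≡ 0ℤ
  outer a n<a = Σ≤-zero N (λ b _ → ·q^-≢ _ (λ a+b≡n → ℕ.<⇒≱ n<a (subst (a ≤_) a+b≡n (ℕ.m≤m+n a b))))

-- Dilation f(q) ↦ f(q^d)

-- The summand of Σsplit is local to Defs; unifying Σsplit d n f with Σ≤ n g recovers it.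
Σsplit-summand : ℕ → ℕ → (ℕ → ℕ → ℤ) → ℕ → ℤ
Σsplit-summand d n f = summand (Σsplit d n f) refl
  where
  summand : ∀ z {g : ℕ → ℤ} → z ≡ Σ≤ n g → ℕ → ℤ
  summand _ {g} _ = g

Σsplit-cong : ∀ d n {f g : ℕ → ℕ → ℤ} → (∀ t s → t ≤ n → s ≤ n → f t s ≡ g t s) →
              Σsplit d n f ≡ Σsplit d n g
Σsplit-cong d n {f} {g} f≡g = Σ≤-cong n summand-cong
  where
  summand-cong : ∀ s → s ≤ n → Σsplit-summand d n f s ≡ Σsplit-summand d n g s
  summand-cong s s≤n with d ℕ.* s ≤? n
  ... | yes _ = f≡g (n ∸ d ℕ.* s) s (ℕ.m∸n≤m n (d ℕ.* s)) s≤n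
  ... | no  _ = refl

module Dilation (d : ℕ) .{{_ : NonZero d}} where

  dilate : Series → Series
  dilate f n = Σ≤ n (λ s → (f s ·q^ (d ℕ.* s)) n)

  dilate-extend : ∀ f {n} N → n ≤ N → dilate f n ≡ Σ≤ N (λ s → (f s ·q^ (d ℕ.* s)) n)
  dilate-extend f {n} N n≤N = sym (Σ≤-extend N n≤N beyond)
    where
    beyond : ∀ s → n < s → (f s ·q^ (d ℕ.* s)) n ≡ 0ℤ
    beyond s n<s = ·q^-≢ (f s) (λ ds≡n → ℕ.<⇒≱ n<s (subst (s ≤_) ds≡n (ℕ.m≤n*m s d)))

  dilate-cong : ∀ {f g} → f ≗ g → dilate f ≗ dilate g
  dilate-cong f≗g n = Σ≤-cong n (λ s _ → cong (λ c → (c ·q^ (d ℕ.* s)) n) (f≗g s))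

  dilate-⊕ : ∀ f g → dilate (f ⊕ g) ≗ dilate f ⊕ dilate g
  dilate-⊕ f g n = trans (Σ≤-cong n (λ s _ → +-·q^ (f s) (g s) (d ℕ.* s) n)) (Σ≤-distrib-+ n _ _)

  dilate-·q^ : ∀ c a → dilate (c ·q^ a) ≗ c ·q^ (d ℕ.* a)
  dilate-·q^ c a n with a ≤? n
  ... | yes a≤n = trans (Σ≤-single n a≤n others) (cong (λ x → (x ·q^ (d ℕ.* a)) n) (·q^-≡ c {a} refl))
    where
    others : ∀ s → s ≤ n → s ≢ a → ((c ·q^ a) s ·q^ (d ℕ.* s)) n ≡ 0ℤ
    others s _ s≢a = trans (cong (λ x → (x ·q^ (d ℕ.* s)) n) (·q^-≢ c (s≢a ∘ sym))) (0·q^ (d ℕ.* s) n)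
  ... | no  a≰n = trans (Σ≤-zero n vanish) (sym (·q^-≢ c da≢n))
    where
    vanish : ∀ s → s ≤ n → ((c ·q^ a) s ·q^ (d ℕ.* s)) n ≡ 0ℤ
    vanish s s≤n = trans (cong (λ x → (x ·q^ (d ℕ.* s)) n) (·q^-≢ c (λ a≡s → a≰n (subst (_≤ n) (sym a≡s) s≤n))))
                         (0·q^ (d ℕ.* s) n)
    da≢n : d ℕ.* a ≢ n
    da≢n da≡n = a≰n (subst (a ≤_) da≡n (ℕ.m≤n*m a d))

  dilate-one : dilate one ≗ one
  dilate-one n = begin
    dilate one n              ≡⟨ dilate-cong one≗1·q^0 n ⟩
    dilate (1ℤ ·q^ 0) n       ≡⟨ dilate-·q^ 1ℤ 0 n ⟩
    (1ℤ ·q^ (d ℕ.* 0)) n      ≡⟨ cong (λ e → (1ℤ ·q^ e) n) (ℕ.*-zeroʳ d) ⟩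
    (1ℤ ·q^ 0) n              ≡⟨ one≗1·q^0 n ⟨
    one n                     ∎

  dilate-⊛ : ∀ f g → dilate (f ⊛ g) ≗ dilate f ⊛ dilate g
  dilate-⊛ f g n = trans lhs≡ (sym rhs≡)
    where
    term : ℕ → ℕ → Series
    term a b = (f a * g b) ·q^ (d ℕ.* a ℕ.+ d ℕ.* b)
    lhs≡ : dilate (f ⊛ g) n ≡ Σ≤ n (λ a → Σ≤ n (λ b → term a b n))
    lhs≡ = begin
      Σ≤ n (λ s → ((f ⊛ g) s ·q^ (d ℕ.* s)) n)
        ≡⟨ Σ≤-cong n (λ s s≤n → cong (λ x → (x ·q^ (d ℕ.* s)) n) (⊛-as-double-sum f g n s≤n)) ⟩
      Σ≤ n (λ s → (Σ≤ n (λ a → Σ≤ n (λ b → ((f a * g b) ·q^ (a ℕ.+ b)) s)) ·q^ (d ℕ.* s)) n)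
        ≡⟨ Σ≤-cong n (λ s _ → trans (Σ≤-·q^ n _ (d ℕ.* s) n)
                                    (Σ≤-cong n (λ a _ → Σ≤-·q^ n _ (d ℕ.* s) n))) ⟩
      Σ≤ n (λ s → Σ≤ n (λ a → Σ≤ n (λ b → ((((f a * g b) ·q^ (a ℕ.+ b)) s) ·q^ (d ℕ.* s)) n)))
        ≡⟨ Σ≤-rotate n n n _ ⟩
      Σ≤ n (λ a → Σ≤ n (λ b → dilate ((f a * g b) ·q^ (a ℕ.+ b)) n))
        ≡⟨ Σ≤-cong n (λ a _ → Σ≤-cong n (λ b _ →
             trans (dilate-·q^ (f a * g b) (a ℕ.+ b) n)
                   (cong (λ e → ((f a * g b) ·q^ e) n) (ℕ.*-distribˡ-+ d a b)))) ⟩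
      Σ≤ n (λ a → Σ≤ n (λ b → term a b n))
        ∎
    rhs≡ : (dilate f ⊛ dilate g) n ≡ Σ≤ n (λ a → Σ≤ n (λ b → term a b n))
    rhs≡ = begin
      Σ≤ n (λ i → dilate f i * dilate g (n ∸ i))
        ≡⟨ Σ≤-cong n (λ i i≤n → cong₂ _*_ (dilate-extend f n i≤n) (dilate-extend g n (ℕ.m∸n≤m n i))) ⟩
      Σ≤ n (λ i → Σ≤ n (λ a → (f a ·q^ (d ℕ.* a)) i) * Σ≤ n (λ b → (g b ·q^ (d ℕ.* b)) (n ∸ i)))
        ≡⟨ Σ≤-cong n (λ i _ → Σ≤-*-Σ≤ n n _ _) ⟩
      Σ≤ n (λ i → Σ≤ n (λ a → Σ≤ n (λ b → (f a ·q^ (d ℕ.* a)) i * (g b ·q^ (d ℕ.* b)) (n ∸ i))))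
        ≡⟨ Σ≤-rotate n n n _ ⟩
      Σ≤ n (λ a → Σ≤ n (λ b → ((f a ·q^ (d ℕ.* a)) ⊛ (g b ·q^ (d ℕ.* b))) n))
        ≡⟨ Σ≤-cong n (λ a _ → Σ≤-cong n (λ b _ → ·q^-⊛-·q^ (f a) (g b) (d ℕ.* a) (d ℕ.* b) n)) ⟩
      Σ≤ n (λ a → Σ≤ n (λ b → term a b n))
        ∎

  ⊛-dilate : ∀ A B n → (A ⊛ dilate B) n ≡ Σsplit d n (λ t s → A t * B s)
  ⊛-dilate A B n = begin
    (A ⊛ dilate B) n
      ≡⟨ ⊛-comm A (dilate B) n ⟩
    Σ≤ n (λ i → dilate B i * A (n ∸ i))
      ≡⟨ Σ≤-cong n (λ i i≤n → cong (_* A (n ∸ i)) (dilate-extend B n i≤n)) ⟩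
    Σ≤ n (λ i → Σ≤ n (λ s → (B s ·q^ (d ℕ.* s)) i) * A (n ∸ i))
      ≡⟨ Σ≤-cong n (λ i _ → *-distribʳ-Σ≤ n _ _) ⟩
    Σ≤ n (λ i → Σ≤ n (λ s → (B s ·q^ (d ℕ.* s)) i * A (n ∸ i)))
      ≡⟨ Σ≤-comm n n _ ⟩
    Σ≤ n (λ s → ((B s ·q^ (d ℕ.* s)) ⊛ A) n)
      ≡⟨ Σ≤-cong n (λ s _ → summand s) ⟩
    Σsplit d n (λ t s → A t * B s)
      ∎
    where
    summand : ∀ s → ((B s ·q^ (d ℕ.* s)) ⊛ A) n ≡ Σsplit-summand d n (λ t s → A t * B s) s
    summand s with d ℕ.* s ≤? n
    ... | yes ds≤n = trans (·q^-⊛ (B s) A ds≤n) (ℤ.*-comm (B s) (A (n ∸ d ℕ.* s)))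
    ... | no  ds≰n = ·q^-⊛-> (B s) A (ℕ.≰⇒> ds≰n)

-- The factors 1 - q^m and 1/(1 - q^m)

OneBelow : ℕ → Series → Set
OneBelow m f = ∀ i → i < m → f i ≡ one i

⊛-OneBelow : ∀ {m f} → OneBelow m f → ∀ g i → i < m → (f ⊛ g) i ≡ g i
⊛-OneBelow f≡1 g i i<m =
  trans (Σ≤-cong i (λ j j≤i → cong (_* g (i ∸ j)) (f≡1 j (ℕ.≤-<-trans j≤i i<m))))
        (⊛-identityˡ g i)

pow-OneBelow : ∀ {m f} → OneBelow m f → ∀ j → OneBelow m (pow f j)
pow-OneBelow f≡1 zero    i _   = refl
pow-OneBelow {f = f} f≡1 (suc j) i i<m =
  trans (⊛-OneBelow f≡1 (pow f j) i i<m) (pow-OneBelow f≡1 j i i<m)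

oneMinusQ-OneBelow : ∀ m → OneBelow (suc m) (oneMinusQ (suc m))
oneMinusQ-OneBelow m zero    _ = refl
oneMinusQ-OneBelow m (suc i) i<m with suc i ≟ suc m
... | yes 1+i≡1+m = ⊥-elim (ℕ.<⇒≢ i<m 1+i≡1+m)
... | no  _       = refl

geomQ≡one-% : ∀ m n → geomQ (suc m) n ≡ one (n % suc m)
geomQ≡one-% m n with n % suc m
... | zero  = refl
... | suc _ = refl

geomQ-OneBelow : ∀ m → OneBelow (suc m) (geomQ (suc m))
geomQ-OneBelow m i i<m = trans (geomQ≡one-% m i) (cong one (DM.m<n⇒m%n≡m i<m))

geomQ-periodic : ∀ m {n} → suc m ≤ n → geomQ (suc m) (n ∸ suc m) ≡ geomQ (suc m) n
geomQ-periodic m {n} m≤n = trans (geomQ≡one-% m (n ∸ suc m))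
  (trans (cong one (DM.m≤n⇒[n∸m]%m≡n%m m≤n)) (sym (geomQ≡one-% m n)))

factor-OneBelow : ∀ K m → OneBelow (suc m) (factor K (suc m))
factor-OneBelow (+ j)    m = pow-OneBelow (oneMinusQ-OneBelow m) j
factor-OneBelow -[1+ j ] m = pow-OneBelow (geomQ-OneBelow m) (suc j)

partialProd-stable : ∀ K {t} N → t ≤ N → partialProd K N t ≡ etaCoeff K t
partialProd-stable K zero    z≤n = refl
partialProd-stable K {t} (suc N) t≤1+N with ℕ.m≤n⇒m<n∨m≡n t≤1+N
... | inj₁ t<1+N = trans (⊛-OneBelow (factor-OneBelow K N) (partialProd K N) t t<1+N)
                         (partialProd-stable K N (ℕ.≤-pred t<1+N))
... | inj₂ refl  = refl

oneMinusQ≗ : ∀ m → oneMinusQ (suc m) ≗ one ⊕ (-1ℤ ·q^ suc m)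
oneMinusQ≗ m zero = refl
oneMinusQ≗ m (suc n) with suc n ≟ suc m
... | yes n≡m = sym (trans (ℤ.+-identityˡ _) (·q^-≡ -1ℤ (sym n≡m)))
... | no  n≢m = sym (trans (ℤ.+-identityˡ _) (·q^-≢ -1ℤ (n≢m ∘ sym)))

oneMinusQ-⊛-geomQ : ∀ m → oneMinusQ (suc m) ⊛ geomQ (suc m) ≗ one
oneMinusQ-⊛-geomQ m n = begin
  (oneMinusQ (suc m) ⊛ G) n                 ≡⟨ ⊛-cong {g = G} (oneMinusQ≗ m) (λ _ → refl) n ⟩
  ((one ⊕ (-1ℤ ·q^ suc m)) ⊛ G) n           ≡⟨ ⊛-distribʳ one (-1ℤ ·q^ suc m) G n ⟩
  (one ⊛ G) n + ((-1ℤ ·q^ suc m) ⊛ G) n     ≡⟨ cong (_+ ((-1ℤ ·q^ suc m) ⊛ G) n) (⊛-identityˡ G n) ⟩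
  G n + ((-1ℤ ·q^ suc m) ⊛ G) n             ≡⟨ cancel (suc m ≤? n) ⟩
  one n                                     ∎
  where
  G : Series
  G = geomQ (suc m)
  cancel : Dec (suc m ≤ n) → G n + ((-1ℤ ·q^ suc m) ⊛ G) n ≡ one n
  cancel (yes m<n) = begin
    G n + ((-1ℤ ·q^ suc m) ⊛ G) n    ≡⟨ cong (λ x → G n + x) (·q^-⊛ -1ℤ G m<n) ⟩
    G n + -1ℤ * G (n ∸ suc m)        ≡⟨ cong (λ x → G n + -1ℤ * x) (geomQ-periodic m m<n) ⟩
    G n + -1ℤ * G n                  ≡⟨ cong (λ x → G n + x) (ℤ.-1*i≡-i (G n)) ⟩
    G n - G n                        ≡⟨ ℤ.+-inverseʳ (G n) ⟩
    0ℤ                               ≡⟨ one-pos m<n ⟨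
    one n                            ∎
    where
    one-pos : ∀ {n} → suc m ≤ n → one n ≡ 0ℤ
    one-pos (s≤s _) = refl
  cancel (no m≮n) = trans (cong (λ x → G n + x) (·q^-⊛-> -1ℤ G (ℕ.≰⇒> m≮n)))
                          (trans (ℤ.+-identityʳ (G n)) (geomQ-OneBelow m n (ℕ.≰⇒> m≮n)))

-- Congruence modulo d

module Modular (d : ℕ) where

  infix 4 _≈_ _≋_

  _≈_ : ℤ → ℤ → Set
  x ≈ y = + d Signed.∣ x - y

  ≈-reflexive : ∀ {x y} → x ≡ y → x ≈ y
  ≈-reflexive {x} refl = Signed.divides 0ℤ (ℤ.+-inverseʳ x)

  ≈-sym : ∀ x y → x ≈ y → y ≈ x
  ≈-sym x y x≈y = subst (+ d Signed.∣_) (negate x y) (Signed.∣m⇒∣-m x≈y)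
    where
    negate : ∀ x y → - (x - y) ≡ y - x
    negate = solve-∀

  ≈-trans : ∀ x y z → x ≈ y → y ≈ z → x ≈ z
  ≈-trans x y z x≈y y≈z = subst (+ d Signed.∣_) (telescope x y z) (Signed.∣m∣n⇒∣m+n x≈y y≈z)
    where
    telescope : ∀ x y z → (x - y) + (y - z) ≡ x - z
    telescope = solve-∀

  ≈-+-cong : ∀ x x' y y' → x ≈ x' → y ≈ y' → x + y ≈ x' + y'
  ≈-+-cong x x' y y' x≈x' y≈y' = subst (+ d Signed.∣_) (regroup x x' y y') (Signed.∣m∣n⇒∣m+n x≈x' y≈y')
    where
    regroup : ∀ x x' y y' → (x - x') + (y - y') ≡ (x + y) - (x' + y')
    regroup = solve-∀

  ≈-*-congʳ : ∀ c x y → x ≈ y → x * c ≈ y * c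
  ≈-*-congʳ c x y x≈y = subst (+ d Signed.∣_) (distrib c x y) (Signed.∣m⇒∣m*n c x≈y)
    where
    distrib : ∀ c x y → (x - y) * c ≡ x * c - y * c
    distrib = solve-∀

  Σ≤-cong-≈ : ∀ n (f g : ℕ → ℤ) → (∀ i → f i ≈ g i) → Σ≤ n f ≈ Σ≤ n g
  Σ≤-cong-≈ zero    f g f≈g = f≈g 0
  Σ≤-cong-≈ (suc n) f g f≈g =
    ≈-+-cong (Σ≤ n f) (Σ≤ n g) (f (suc n)) (g (suc n)) (Σ≤-cong-≈ n f g f≈g) (f≈g (suc n))

  record _≋_ (f g : Series) : Set where
    constructor coefficientwise
    field coefficient : ∀ n → f n ≈ g n
  open _≋_ public

  ≗⇒≋ : ∀ {f g} → f ≗ g → f ≋ g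
  ≗⇒≋ f≗g = coefficientwise (λ n → ≈-reflexive (f≗g n))

  ≋-isEquivalence : IsEquivalence _≋_
  ≋-isEquivalence = record
    { refl  = ≗⇒≋ (λ _ → refl)
    ; sym   = λ {f} {g} f≋g → coefficientwise (λ n → ≈-sym (f n) (g n) (coefficient f≋g n))
    ; trans = λ {f} {g} {h} f≋g g≋h →
                coefficientwise (λ n → ≈-trans (f n) (g n) (h n) (coefficient f≋g n) (coefficient g≋h n))
    }
  open IsEquivalence ≋-isEquivalence using () renaming (trans to ≋-trans)

  ⊕-cong-≋ : ∀ {f f' g g'} → f ≋ f' → g ≋ g' → f ⊕ g ≋ f' ⊕ g'
  ⊕-cong-≋ {f} {f'} {g} {g'} f≋f' g≋g' =
    coefficientwise (λ n → ≈-+-cong (f n) (f' n) (g n) (g' n) (coefficient f≋f' n) (coefficient g≋g' n))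

  ⊛-congˡ-≋ : ∀ h {f f'} → f ≋ f' → f ⊛ h ≋ f' ⊛ h
  ⊛-congˡ-≋ h {f} {f'} f≋f' = coefficientwise (λ n →
    Σ≤-cong-≈ n _ _ (λ i → ≈-*-congʳ (h (n ∸ i)) (f i) (f' i) (coefficient f≋f' i)))

  ⊛-cong-≋ : ∀ {f f' g g'} → f ≋ f' → g ≋ g' → f ⊛ g ≋ f' ⊛ g'
  ⊛-cong-≋ {f} {f'} {g} {g'} f≋f' g≋g' =
    ≋-trans (⊛-congˡ-≋ g f≋f')
      (≋-trans (≗⇒≋ (⊛-comm f' g)) (≋-trans (⊛-congˡ-≋ f' g≋g') (≗⇒≋ (⊛-comm g' f'))))

  seriesSemiring : CommutativeSemiring 0ℓ 0ℓ
  seriesSemiring = record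
    { Carrier = Series
    ; _≈_ = _≋_
    ; _+_ = _⊕_
    ; _*_ = _⊛_
    ; 0# = 𝟘
    ; 1# = one
    ; isCommutativeSemiring = isCommutativeSemiringˡ record
      { +-isCommutativeMonoid = record
        { isMonoid = record
          { isSemigroup = record
            { isMagma = record { isEquivalence = ≋-isEquivalence ; ∙-cong = ⊕-cong-≋ }
            ; assoc = λ f g h → ≗⇒≋ (λ n → ℤ.+-assoc (f n) (g n) (h n))
            }
          ; identity = (λ f → ≗⇒≋ (ℤ.+-identityˡ ∘ f)) , (λ f → ≗⇒≋ (ℤ.+-identityʳ ∘ f))
          }
        ; comm = λ f g → ≗⇒≋ (λ n → ℤ.+-comm (f n) (g n))
        }
      ; *-isCommutativeMonoid = record
        { isMonoid = record
          { isSemigroup = record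
            { isMagma = record { isEquivalence = ≋-isEquivalence ; ∙-cong = ⊛-cong-≋ }
            ; assoc = λ f g h → ≗⇒≋ (⊛-assoc f g h)
            }
          ; identity = (λ f → ≗⇒≋ (⊛-identityˡ f)) , (λ f → ≗⇒≋ (⊛-identityʳ f))
          }
        ; comm = λ f g → ≗⇒≋ (⊛-comm f g)
        }
      ; distribʳ = λ h f g → ≗⇒≋ (⊛-distribʳ f g h)
      ; zeroˡ = λ g → ≗⇒≋ (⊛-zeroˡ g)
      }
    }

  open import Algebra.Properties.Monoid.Mult (CommutativeSemiring.+-monoid seriesSemiring)
    using (_×_)

  ×-coefficient : ∀ k f n → (k × f) n ≡ + k * f n
  ×-coefficient zero    f n = sym (ℤ.*-zeroˡ (f n))
  ×-coefficient (suc k) f n = begin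
    f n + (k × f) n        ≡⟨ cong (λ x → f n + x) (×-coefficient k f n) ⟩
    f n + + k * f n        ≡⟨ cong (_+ + k * f n) (ℤ.*-identityˡ (f n)) ⟨
    1ℤ * f n + + k * f n   ≡⟨ ℤ.*-distribʳ-+ (f n) 1ℤ (+ k) ⟨
    + suc k * f n          ∎

  d×≋𝟘 : ∀ f → d × f ≋ 𝟘
  d×≋𝟘 f = coefficientwise (λ n →
    subst (+ d Signed.∣_) (trans (sym (×-coefficient d f n)) (sym (ℤ.+-identityʳ _)))
          (Signed.∣m⇒∣m*n (f n) (Signed.∣-refl {+ d})))

  open import Algebra.Properties.Semiring.Exp (CommutativeSemiring.semiring seriesSemiring)
    using (_^_) public

  pow≡^ : ∀ f j → pow f j ≡ f ^ j
  pow≡^ f zero    = refl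
  pow≡^ f (suc j) = cong (f ⊛_) (pow≡^ f j)

-- The congruence modulo an odd prime

-1^odd : ∀ l → l % 2 ≡ 1 → -1ℤ ℤ.^ l ≡ -1ℤ
-1^odd l l-odd = subst (λ e → -1ℤ ℤ.^ e ≡ -1ℤ) (sym l≡1+[l/2]*2) (-1^[1+r*2] (l DM./ 2))
  where
  l≡1+[l/2]*2 : l ≡ suc (l DM./ 2 ℕ.* 2)
  l≡1+[l/2]*2 = trans (DM.m≡m%n+[m/n]*n l 2) (cong (ℕ._+ l DM./ 2 ℕ.* 2) l-odd)
  -1^[1+r*2] : ∀ r → -1ℤ ℤ.^ suc (r ℕ.* 2) ≡ -1ℤ
  -1^[1+r*2] zero    = refl
  -1^[1+r*2] (suc r) = cong (λ x → -1ℤ * (-1ℤ * x)) (-1^[1+r*2] r)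

module Frobenius {l : ℕ} (l-prime : Prime l) (l-odd : l % 2 ≡ 1) where

  private instance
    l-nonZero : NonZero l
    l-nonZero = prime⇒nonZero l-prime

  open Modular l
  open Dilation l
  open CommutativeSemiring seriesSemiring using (setoid; *-cong; *-congˡ; *-commutativeSemigroup)
  open import Algebra.Properties.Semiring.Exp (CommutativeSemiring.semiring seriesSemiring)
    using (^-congˡ)
  open import Algebra.Properties.CommutativeSemigroup *-commutativeSemigroup
    using () renaming (interchange to ⊛-interchange)
  open import Relation.Binary.Reasoning.Setoid setoid
    using (step-≈-⟩; step-≈-⟨) renaming (begin_ to begin≋_; _∎ to _∎≋)

  oneMinusQ^l≋dilate : ∀ m → oneMinusQ (suc m) ^ l ≋ dilate (oneMinusQ (suc m))
  oneMinusQ^l≋dilate m = begin≋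
    O ^ l                                ≈⟨ ^-congˡ l (≗⇒≋ (oneMinusQ≗ m)) ⟩
    (one ⊕ X) ^ l                        ≈⟨ freshmans-dream seriesSemiring l-prime d×≋𝟘 one X ⟩
    one ^ l ⊕ X ^ l                      ≈⟨ ⊕-cong-≋ (1#^≈1# seriesSemiring l) (≗⇒≋ X^l≗) ⟩
    one ⊕ (-1ℤ ·q^ (l ℕ.* suc m))        ≈⟨ ≗⇒≋ dilate-O≗ ⟨
    dilate O                             ∎≋
    where
    O X : Series
    O = oneMinusQ (suc m)
    X = -1ℤ ·q^ suc m
    X^l≗ : X ^ l ≗ -1ℤ ·q^ (l ℕ.* suc m)
    X^l≗ n = begin
      (X ^ l) n                           ≡⟨ cong (λ h → h n) (pow≡^ X l) ⟨
      pow X l n                           ≡⟨ pow-·q^ -1ℤ (suc m) l n ⟩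
      ((-1ℤ ℤ.^ l) ·q^ (l ℕ.* suc m)) n   ≡⟨ cong (λ c → (c ·q^ (l ℕ.* suc m)) n) (-1^odd l l-odd) ⟩
      (-1ℤ ·q^ (l ℕ.* suc m)) n           ∎
    dilate-O≗ : dilate O ≗ one ⊕ (-1ℤ ·q^ (l ℕ.* suc m))
    dilate-O≗ n = begin
      dilate O n                          ≡⟨ dilate-cong (oneMinusQ≗ m) n ⟩
      dilate (one ⊕ X) n                  ≡⟨ dilate-⊕ one X n ⟩
      dilate one n + dilate X n           ≡⟨ cong₂ _+_ (dilate-one n) (dilate-·q^ -1ℤ (suc m) n) ⟩
      one n + (-1ℤ ·q^ (l ℕ.* suc m)) n   ∎

  geomQ^k≋ : ∀ m {k} → k ≤ l →
    pow (geomQ (suc m)) k ≋ pow (oneMinusQ (suc m)) (l ∸ k) ⊛ dilate (geomQ (suc m))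
  geomQ^k≋ m {k} k≤l =
    subst₂ _≋_ (sym (pow≡^ G k)) (cong (_⊛ dilate G) (sym (pow≡^ O (l ∸ k))))
      (power-of-inverse seriesSemiring {x = G} {y = O} {z = dilate O} {w = dilate G}
                        G⊛O≋one DO⊛DG≋one (oneMinusQ^l≋dilate m) k≤l)
    where
    O G : Series
    O = oneMinusQ (suc m)
    G = geomQ (suc m)
    G⊛O≋one : G ⊛ O ≋ one
    G⊛O≋one = ≗⇒≋ (λ n → trans (⊛-comm G O n) (oneMinusQ-⊛-geomQ m n))
    DO⊛DG≋one : dilate O ⊛ dilate G ≋ one
    DO⊛DG≋one = ≗⇒≋ (λ n → trans (sym (dilate-⊛ O G n))
                                 (trans (dilate-cong (oneMinusQ-⊛-geomQ m) n) (dilate-one n)))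

  partialProd-≋ : ∀ {k} → suc k ≤ l → ∀ N →
    partialProd -[1+ k ] N ≋ partialProd (+ (l ∸ suc k)) N ⊛ dilate (partialProd -1ℤ N)
  partialProd-≋ 1+k≤l zero = ≗⇒≋ (λ n → sym (trans (⊛-identityˡ (dilate one) n) (dilate-one n)))
  partialProd-≋ {k} 1+k≤l (suc N) = begin≋
    pow G (suc k) ⊛ P₋ₖ N
      ≈⟨ *-cong (geomQ^k≋ N 1+k≤l) (partialProd-≋ 1+k≤l N) ⟩
    (pow O (l ∸ suc k) ⊛ dilate G) ⊛ (Pₗ₋ₖ N ⊛ dilate (P₋₁ N))
      ≈⟨ ⊛-interchange (pow O (l ∸ suc k)) (dilate G) (Pₗ₋ₖ N) (dilate (P₋₁ N)) ⟩
    (pow O (l ∸ suc k) ⊛ Pₗ₋ₖ N) ⊛ (dilate G ⊛ dilate (P₋₁ N))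
      ≈⟨ *-congˡ {pow O (l ∸ suc k) ⊛ Pₗ₋ₖ N} (≗⇒≋ dilate-step) ⟩
    Pₗ₋ₖ (suc N) ⊛ dilate (P₋₁ (suc N))
      ∎≋
    where
    O G : Series
    O = oneMinusQ (suc N)
    G = geomQ (suc N)
    P₋ₖ Pₗ₋ₖ P₋₁ : ℕ → Series
    P₋ₖ = partialProd -[1+ k ]
    Pₗ₋ₖ = partialProd (+ (l ∸ suc k))
    P₋₁ = partialProd -1ℤ
    dilate-step : dilate G ⊛ dilate (P₋₁ N) ≗ dilate ((G ⊛ one) ⊛ P₋₁ N)
    dilate-step n = trans (sym (dilate-⊛ G (P₋₁ N) n))
                          (dilate-cong (⊛-cong {g = P₋₁ N} (sym ∘ ⊛-identityʳ G) (λ _ → refl)) n)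

  τ-congruence : ∀ {k} → suc k ≤ l → ∀ n →
    τ -[1+ k ] (suc n) ≈ Σsplit l n (λ t s → τ (+ (l ∸ suc k)) (suc t) * p s)
  τ-congruence {k} 1+k≤l n = subst (τ -[1+ k ] (suc n) ≈_) split≡ (coefficient (partialProd-≋ 1+k≤l n) n)
    where
    split≡ : (partialProd (+ (l ∸ suc k)) n ⊛ dilate (partialProd -1ℤ n)) n
             ≡ Σsplit l n (λ t s → τ (+ (l ∸ suc k)) (suc t) * p s)
    split≡ = trans (⊛-dilate (partialProd (+ (l ∸ suc k)) n) (partialProd -1ℤ n) n)
      (Σsplit-cong l n (λ t s t≤n s≤n →
        cong₂ _*_ (partialProd-stable (+ (l ∸ suc k)) n t≤n) (partialProd-stable -1ℤ n s≤n)))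

mainTheorem2 : (k l : ℕ) → 2 ≤ k → k < l → Prime l → l % 2 ≡ 1 →
    (n : ℕ) →
    (+ l) ∣ (τ (- (+ k)) (ℕ.suc n)
             - Σsplit l n (λ t s → τ (+ l - + k) (ℕ.suc t) * p s))
mainTheorem2 (suc k) l _ k<l l-prime l-odd n =
  Signed.∣⇒∣ᵤ (subst (λ K → + l Signed.∣ τ -[1+ k ] (suc n) - Σsplit l n (λ t s → τ K (suc t) * p s))
                     (sym l-k≡) (τ-congruence (ℕ.<⇒≤ k<l) n))
  where
  open Frobenius l-prime l-odd
  l-k≡ : + l - + suc k ≡ + (l ∸ suc k)
  l-k≡ = trans (ℤ.m-n≡m⊖n l (suc k)) (ℤ.⊖-≥ (ℕ.<⇒≤ k<l))
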